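{- No tall strider is a willow.
   Context: A tall strider is a 12-vertex graph having a clique $C=\{x_1,x_2,x_3\}$ of size $3$ such that $N(x_1)\setminus C$, $N(x_2)\setminus C$, $N(x_3)\setminus C$ are pairwise disjoint cliques of size $3$ (edges between these cliques are allowed). For a positive integer $n$, a graph $G$ is an $n$-willow if there exists an oriented tree $T$ with $V(G)\subseteq V(T)$ such that for all distinct $u,v\in V(G)$, $u$ and $v$ are adjacent in $G$ if and only if $T$ has a directed path from $u$ to $v$ or from $v$ to $u$ whose length is not a multiple of $n$. A willow is a graph that is an $n$-willow for some positive integer $n$. -}

module Defs where

open import Data.Nat using (ℕ; zero; suc; _>_)
open import Data.Nat.Divisibility using (_∣_)
open import Data.Fin using (Fin)
open import Data.List using (List; []; _∷_)
open import Data.List.Relation.Unary.Unique.Propositional using (Unique)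
open import Data.Product using (Σ; ∃; ∃-syntax; _×_; _,_)
open import Data.Sum using (_⊎_)
open import Data.Empty using (⊥)
open import Relation.Nullary using (¬_)
open import Relation.Binary.PropositionalEquality using (_≡_; _≢_)
open import Function.Bundles using (_⇔_)
open import Function.Definitions using (Injective)

record Graph (n : ℕ) : Set₁ where
  field
    Adj    : Fin n → Fin n → Set
    sym    : ∀ {u v} → Adj u v → Adj v u
    irrefl : ∀ {u} → ¬ Adj u u
open Graph public

data Walk {m : ℕ} (R : Fin m → Fin m → Set) : Fin m → Fin m → ℕ → Set where
  nil  : ∀ {u} → Walk R u u zero
  cons : ∀ {u w v k} → R u w → Walk R w v k → Walk R u v (suc k)

verts : ∀ {m} {R : Fin m → Fin m → Set} {u v k} → Walk R u v k → List (Fin m)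
verts (nil {u})             = u ∷ []
verts (cons {u = u} _ rest) = u ∷ verts rest

Path : ∀ {m} → (Fin m → Fin m → Set) → Fin m → Fin m → ℕ → Set
Path R u v k = Σ (Walk R u v k) λ w → Unique (verts w)

tailVerts : ∀ {m} {R : Fin m → Fin m → Set} {u v k} → Walk R u v k → List (Fin m)
tailVerts nil          = []
tailVerts (cons _ rest) = verts rest

HasCycle : ∀ {m} → (Fin m → Fin m → Set) → Set
HasCycle {m} R =
  Σ (Fin m) λ u → Σ ℕ λ k → Σ (Walk R u u (suc (suc (suc k)))) λ w →
    Unique (tailVerts w)

record OrientedTree : Set₁ where
  field
    size     : ℕ
    Arc      : Fin size → Fin size → Set
    noLoop   : ∀ {u} → ¬ Arc u u
    oriented : ∀ {u v} → Arc u v → ¬ Arc v u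
  Edge : Fin size → Fin size → Set
  Edge u v = Arc u v ⊎ Arc v u
  field
    connected : ∀ u v → ∃[ k ] Walk Edge u v k
    acyclic   : ¬ HasCycle Edge
open OrientedTree public

IsWillowVia : ∀ {N} → ℕ → Graph N → (T : OrientedTree) → (Fin N → Fin (size T)) → Set
IsWillowVia {N} n G T f =
  Injective _≡_ _≡_ f ×
  (∀ (u v : Fin N) → u ≢ v →
     Adj G u v ⇔
       (∃[ k ] ((Path (Arc T) (f u) (f v) k ⊎ Path (Arc T) (f v) (f u) k) × ¬ (n ∣ k))))

NWillow : ∀ {N} → ℕ → Graph N → Set₁
NWillow n G = Σ OrientedTree λ T → Σ (Fin _ → Fin (size T)) λ f → IsWillowVia n G T f

Willow : ∀ {N} → Graph N → Set₁
Willow G = Σ ℕ λ n → n > 0 × NWillow n G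

module _ {N : ℕ} (G : Graph N) where

  NbrOutside : Fin N → Fin N → Fin N → Fin N → Fin N → Set
  NbrOutside a b c x y = Adj G x y × y ≢ a × y ≢ b × y ≢ c

  IsClique3 : (Fin N → Set) → Set
  IsClique3 S = Σ (Fin N) λ p → Σ (Fin N) λ q → Σ (Fin N) λ r →
    p ≢ q × p ≢ r × q ≢ r ×
    Adj G p q × Adj G p r × Adj G q r ×
    (∀ y → S y ⇔ (y ≡ p ⊎ y ≡ q ⊎ y ≡ r))

  Disjoint : (Fin N → Set) → (Fin N → Set) → Set
  Disjoint S T = ∀ y → S y → T y → ⊥

IsTallStrider : Graph 12 → Set
IsTallStrider G = Σ (Fin 12) λ x₁ → Σ (Fin 12) λ x₂ → Σ (Fin 12) λ x₃ →
  x₁ ≢ x₂ × x₁ ≢ x₃ × x₂ ≢ x₃ ×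
  Adj G x₁ x₂ × Adj G x₁ x₃ × Adj G x₂ x₃ ×
  IsClique3 G (NbrOutside G x₁ x₂ x₃ x₁) ×
  IsClique3 G (NbrOutside G x₁ x₂ x₃ x₂) ×
  IsClique3 G (NbrOutside G x₁ x₂ x₃ x₃) ×
  Disjoint G (NbrOutside G x₁ x₂ x₃ x₁) (NbrOutside G x₁ x₂ x₃ x₂) ×
  Disjoint G (NbrOutside G x₁ x₂ x₃ x₁) (NbrOutside G x₁ x₂ x₃ x₃) ×
  Disjoint G (NbrOutside G x₁ x₂ x₃ x₂) (NbrOutside G x₁ x₂ x₃ x₃)

{-# OPTIONS --safe #-}
-- In an oriented tree every directed walk is a path, so in a willow two distinct
-- vertices are non-adjacent exactly when every directed walk between their images
-- has length divisible by n.  Orient the central triangle x₁x₂x₃ of a tall strider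
-- by the directions of the tree walks; some xᵢ = b lies on walks a ↝ b ↝ c.  Each
-- neighbour y of b outside the centre is adjacent to neither a nor c, and the walk
-- joining it to b extends either a ↝ b to a walk a ↝ y of length ≡ 0, or b ↝ c to a
-- walk y ↝ c of length ≡ 0.  Two adjacent vertices of the same kind would give a walk
-- of length ≢ 0 between a (resp. c) and one of them, so these kinds split the
-- triangle N(b) ∖ C into two independent sets, which is impossible.
module Submission where

open import Defs
open import Level using (Level)
open import Data.Nat using (ℕ; suc; _+_; _≤_; _<_; z≤n; s≤s)
open import Data.Nat.Properties using (m<n⇒m<1+n; +-comm)
open import Data.Nat.Induction using (<-wellFounded)
open import Data.Nat.Divisibility using (_∣_; _∣?_; ∣m+n∣m⇒∣n)
open import Data.Fin using (Fin; _≟_)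
open import Data.List using (_∷_)
open import Data.List.Membership.Propositional using (_∈_)
open import Data.List.Relation.Unary.Any using (here; there; any?)
open import Data.List.Relation.Unary.All.Properties.Core using (¬Any⇒All¬)
open import Data.List.Relation.Unary.Unique.Propositional using (Unique)
import Data.List.Relation.Unary.All as All
import Data.List.Relation.Unary.AllPairs as AllPairs
open import Data.Product using (∃-syntax; ∃₂; _×_; _,_; proj₁; proj₂)
open import Data.Sum using (_⊎_; inj₁; inj₂)
import Data.Sum as Sum
open import Data.Empty using (⊥-elim)
open import Function using (_∘_)
open import Function.Bundles using (Equivalence)
open import Induction.WellFounded using (Acc; acc)
open import Relation.Nullary using (¬_; yes; no)
open import Relation.Nullary.Decidable using (decidable-stable)
open import Relation.Binary.PropositionalEquality using (_≡_; _≢_; refl; cong; subst; ≢-sym)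
  renaming (sym to ≡-sym)

module _ {m : ℕ} {R : Fin m → Fin m → Set} where

  _++ʷ_ : ∀ {x y z k l} → Walk R x y k → Walk R y z l → Walk R x z (k + l)
  nil       ++ʷ w = w
  cons e w₁ ++ʷ w = cons e (w₁ ++ʷ w)

  walkTo∈verts : ∀ {x y z k} (w : Walk R x y k) → z ∈ verts w → ∃[ j ] j ≤ k × Walk R x z j
  walkTo∈verts nil           (here refl) = 0 , z≤n , nil
  walkTo∈verts (cons _ _)    (here refl) = 0 , z≤n , nil
  walkTo∈verts (cons e rest) (there z∈) with walkTo∈verts rest z∈
  ... | j , j≤k , w = suc j , s≤s j≤k , cons e w

  unique⊎closedSubwalk : ∀ {x y k} (w : Walk R x y k) →
                         Unique (verts w) ⊎ ∃₂ λ z j → j < k × Walk R z z (suc j)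
  unique⊎closedSubwalk nil = inj₁ (All.[] AllPairs.∷ AllPairs.[])
  unique⊎closedSubwalk (cons {u = u} e rest) with unique⊎closedSubwalk rest
  ... | inj₂ (z , j , j<k , closed) = inj₂ (z , j , m<n⇒m<1+n j<k , closed)
  ... | inj₁ unique with any? (u ≟_) (verts rest)
  ...   | no u∉rest = inj₁ (¬Any⇒All¬ (verts rest) u∉rest AllPairs.∷ unique)
  ...   | yes u∈rest with walkTo∈verts rest u∈rest
  ...     | j , j≤k , rest→u = inj₂ (u , j , s≤s j≤k , cons e rest→u)

  mapWalk : ∀ {S : Fin m → Fin m → Set} → (∀ {u v} → R u v → S u v) →
            ∀ {x y k} → Walk R x y k → Walk S x y k
  mapWalk _ nil        = nil
  mapWalk g (cons e w) = cons (g e) (mapWalk g w)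

  verts-mapWalk : ∀ {S : Fin m → Fin m → Set} (g : ∀ {u v} → R u v → S u v) →
                  ∀ {x y k} (w : Walk R x y k) → verts (mapWalk g w) ≡ verts w
  verts-mapWalk _ nil                = refl
  verts-mapWalk g (cons {u = u} _ w) = cong (u ∷_) (verts-mapWalk g w)

module _ (T : OrientedTree) where

  noClosedWalk : ∀ {x k} → ¬ Walk (Arc T) x x (suc k)
  noClosedWalk = go (<-wellFounded _)
    where
    go : ∀ {x k} → Acc _<_ k → ¬ Walk (Arc T) x x (suc k)
    go _ (cons e nil)           = noLoop T e
    go _ (cons e (cons e′ nil)) = oriented T e e′
    go (acc shorter) (cons e rest@(cons _ (cons _ _))) with unique⊎closedSubwalk rest
    ... | inj₁ unique = acyclic T (_ , _ , mapWalk inj₁ (cons e rest) ,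
                                   subst Unique (≡-sym (verts-mapWalk inj₁ rest)) unique)
    ... | inj₂ (_ , _ , j<k , closed) = go (shorter j<k) closed

  walk⇒path : ∀ {x y k} → Walk (Arc T) x y k → Path (Arc T) x y k
  walk⇒path w with unique⊎closedSubwalk w
  ... | inj₁ unique              = w , unique
  ... | inj₂ (_ , _ , _ , closed) = ⊥-elim (noClosedWalk closed)

module _ {a ℓ : Level} {A : Set a} (R : A → A → Set ℓ) where

  Between : A → A → A → Set ℓ
  Between x y z = (R x y × R y z) ⊎ (R z y × R y x)

  someBetween : ∀ {x y z} → R x y ⊎ R y x → R x z ⊎ R z x → R y z ⊎ R z y →
                Between y x z ⊎ Between x y z ⊎ Between x z y
  someBetween (inj₁ xy) (inj₁ _)  (inj₁ yz) = inj₂ (inj₁ (inj₁ (xy , yz)))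
  someBetween (inj₁ _)  (inj₁ xz) (inj₂ zy) = inj₂ (inj₂ (inj₁ (xz , zy)))
  someBetween (inj₁ xy) (inj₂ zx) _         = inj₁ (inj₂ (zx , xy))
  someBetween (inj₂ yx) (inj₁ xz) _         = inj₁ (inj₁ (yx , xz))
  someBetween (inj₂ _)  (inj₂ zx) (inj₁ yz) = inj₂ (inj₂ (inj₂ (yz , zx)))
  someBetween (inj₂ yx) (inj₂ _)  (inj₂ zy) = inj₂ (inj₁ (inj₂ (zy , yx)))

module _ {N : ℕ} (G : Graph N) where

  adj⇒≢ : ∀ {u v} → Adj G u v → u ≢ v
  adj⇒≢ adj refl = irrefl G adj

  NonNeighbour : Fin N → Fin N → Set
  NonNeighbour u v = u ≢ v × ¬ Adj G u v

  nonNeighbour-sym : ∀ {u v} → NonNeighbour u v → NonNeighbour v u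
  nonNeighbour-sym (u≢v , ¬adj) = ≢-sym u≢v , ¬adj ∘ sym G

  PrivateNeighbour : Fin N → Fin N → Fin N → Fin N → Set
  PrivateNeighbour a b c y = Adj G b y × NonNeighbour a y × NonNeighbour c y

  record TriangleIn (P : Fin N → Set) : Set where
    constructor triangle
    field
      {y₁ y₂ y₃} : Fin N
      adj₁₂ : Adj G y₁ y₂
      adj₁₃ : Adj G y₁ y₃
      adj₂₃ : Adj G y₂ y₃
      in₁   : P y₁
      in₂   : P y₂
      in₃   : P y₃

  mapTriangle : ∀ {P Q : Fin N → Set} → (∀ {y} → P y → Q y) → TriangleIn P → TriangleIn Q
  mapTriangle g (triangle a₁₂ a₁₃ a₂₃ p₁ p₂ p₃) = triangle a₁₂ a₁₃ a₂₃ (g p₁) (g p₂) (g p₃)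

  clique3⇒triangle : ∀ {S} → IsClique3 G S → TriangleIn S
  clique3⇒triangle (p , q , r , _ , _ , _ , a₁₂ , a₁₃ , a₂₃ , S⇔) =
    triangle a₁₂ a₁₃ a₂₃ (Equivalence.from (S⇔ p) (inj₁ refl))
                         (Equivalence.from (S⇔ q) (inj₂ (inj₁ refl)))
                         (Equivalence.from (S⇔ r) (inj₂ (inj₂ refl)))

  Independent : (Fin N → Set) → Set
  Independent P = ∀ {y y′} → P y → P y′ → ¬ Adj G y y′

  independent⊎independent⇒noTriangle : ∀ {P Q} → Independent P → Independent Q →
                                       ¬ TriangleIn (λ y → P y ⊎ Q y)
  independent⊎independent⇒noTriangle indP indQ (triangle a₁₂ a₁₃ a₂₃ c₁ c₂ c₃) with c₁ | c₂ | c₃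
  ... | inj₁ p₁ | inj₁ p₂ | _       = indP p₁ p₂ a₁₂
  ... | inj₁ p₁ | inj₂ _  | inj₁ p₃ = indP p₁ p₃ a₁₃
  ... | inj₁ _  | inj₂ q₂ | inj₂ q₃ = indQ q₂ q₃ a₂₃
  ... | inj₂ q₁ | inj₂ q₂ | _       = indQ q₁ q₂ a₁₂
  ... | inj₂ q₁ | inj₁ _  | inj₂ q₃ = indQ q₁ q₃ a₁₃
  ... | inj₂ _  | inj₁ p₂ | inj₁ p₃ = indP p₂ p₃ a₂₃

  record TriangleOfPrivateTriangles : Set where
    constructor privateTriangles
    field
      {x₁ x₂ x₃} : Fin N
      adj₁₂ : Adj G x₁ x₂
      adj₁₃ : Adj G x₁ x₃
      adj₂₃ : Adj G x₂ x₃
      private₁ : TriangleIn (PrivateNeighbour x₂ x₁ x₃)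
      private₂ : TriangleIn (PrivateNeighbour x₁ x₂ x₃)
      private₃ : TriangleIn (PrivateNeighbour x₁ x₃ x₂)

tallStrider⇒triangleOfPrivateTriangles : (G : Graph 12) → IsTallStrider G → TriangleOfPrivateTriangles G
tallStrider⇒triangleOfPrivateTriangles G
  (x₁ , x₂ , x₃ , _ , _ , _ , a₁₂ , a₁₃ , a₂₃ , C₁ , C₂ , C₃ , D₁₂ , D₁₃ , D₂₃) =
  privateTriangles a₁₂ a₁₃ a₂₃ (mapTriangle G private₁ (clique3⇒triangle G C₁))
                               (mapTriangle G private₂ (clique3⇒triangle G C₂))
                               (mapTriangle G private₃ (clique3⇒triangle G C₃))
  where
  S : Fin 12 → Fin 12 → Set
  S = NbrOutside G x₁ x₂ x₃

  nonNeighbour : ∀ {u v y} → Disjoint G (S u) (S v) → S u y → v ≢ y → NonNeighbour G v y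
  nonNeighbour disjoint (adj , outside) v≢y =
    v≢y , λ adj′ → disjoint _ (adj , outside) (adj′ , outside)

  disjoint-sym : ∀ {u v} → Disjoint G (S u) (S v) → Disjoint G (S v) (S u)
  disjoint-sym disjoint y t s = disjoint y s t

  private₁ : ∀ {y} → S x₁ y → PrivateNeighbour G x₂ x₁ x₃ y
  private₁ s@(adj , _ , y≢x₂ , y≢x₃) =
    adj , nonNeighbour D₁₂ s (≢-sym y≢x₂) , nonNeighbour D₁₃ s (≢-sym y≢x₃)

  private₂ : ∀ {y} → S x₂ y → PrivateNeighbour G x₁ x₂ x₃ y
  private₂ s@(adj , y≢x₁ , _ , y≢x₃) =
    adj , nonNeighbour (disjoint-sym D₁₂) s (≢-sym y≢x₁) , nonNeighbour D₂₃ s (≢-sym y≢x₃)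

  private₃ : ∀ {y} → S x₃ y → PrivateNeighbour G x₁ x₃ x₂ y
  private₃ s@(adj , y≢x₁ , y≢x₂ , _) =
    adj , nonNeighbour (disjoint-sym D₁₃) s (≢-sym y≢x₁) , nonNeighbour (disjoint-sym D₂₃) s (≢-sym y≢x₂)

module WillowEmbedding {N : ℕ} {G : Graph N} (n : ℕ) (T : OrientedTree) (f : Fin N → Fin (size T))
                       (willow : IsWillowVia n G T f) where

  _↝[_]_ : Fin N → ℕ → Fin N → Set
  u ↝[ k ] v = Walk (Arc T) (f u) (f v) k

  Reach : Fin N → Fin N → Set
  Reach u v = ∃[ k ] u ↝[ k ] v

  _↝₀_ : Fin N → Fin N → Set
  u ↝₀ v = ∃[ k ] u ↝[ k ] v × n ∣ k

  adjacent⇒walk : ∀ {u v} → Adj G u v → ∃[ k ] (u ↝[ k ] v ⊎ v ↝[ k ] u) × ¬ n ∣ k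
  adjacent⇒walk {u} {v} adj with Equivalence.to (proj₂ willow u v (adj⇒≢ G adj)) adj
  ... | k , path , n∤k = k , Sum.map proj₁ proj₁ path , n∤k

  adjacent⇒reach : ∀ {u v} → Adj G u v → Reach u v ⊎ Reach v u
  adjacent⇒reach adj with adjacent⇒walk adj
  ... | k , walk , _ = Sum.map (k ,_) (k ,_) walk

  nonNeighbour⇒∣ : ∀ {u v k} → NonNeighbour G u v → u ↝[ k ] v → n ∣ k
  nonNeighbour⇒∣ {u} {v} {k} (u≢v , ¬adj) w = decidable-stable (n ∣? k) λ n∤k →
    ¬adj (Equivalence.from (proj₂ willow u v u≢v) (k , inj₁ (walk⇒path T w) , n∤k))

  independent : ∀ {P} → (∀ {y y′ k} → P y → P y′ → y ↝[ k ] y′ → n ∣ k) → Independent G P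
  independent step p p′ adj with adjacent⇒walk adj
  ... | _ , inj₁ w , n∤k = n∤k (step p p′ w)
  ... | _ , inj₂ w , n∤k = n∤k (step p′ p w)

  zeroFrom-independent : ∀ {a} → Independent G (λ y → NonNeighbour G a y × a ↝₀ y)
  zeroFrom-independent = independent λ (_ , r , a↝y , n∣r) (a≁y′ , _) y↝y′ →
    ∣m+n∣m⇒∣n (nonNeighbour⇒∣ a≁y′ (a↝y ++ʷ y↝y′)) n∣r

  zeroTo-independent : ∀ {c} → Independent G (λ y → NonNeighbour G c y × y ↝₀ c)
  zeroTo-independent = independent λ {k = k} (c≁y , _) (_ , r , y′↝c , n∣r) y↝y′ →
    ∣m+n∣m⇒∣n (subst (n ∣_) (+-comm k r)
                (nonNeighbour⇒∣ (nonNeighbour-sym G c≁y) (y↝y′ ++ʷ y′↝c))) n∣r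

  middle⇒noPrivateTriangle : ∀ {a b c} → Reach a b → Reach b c → ¬ TriangleIn G (PrivateNeighbour G a b c)
  middle⇒noPrivateTriangle {a} {b} {c} (p , a↝b) (q , b↝c) =
    independent⊎independent⇒noTriangle G zeroFrom-independent zeroTo-independent ∘ mapTriangle G classify
    where
    classify : ∀ {y} → PrivateNeighbour G a b c y →
               (NonNeighbour G a y × a ↝₀ y) ⊎ (NonNeighbour G c y × y ↝₀ c)
    classify (b~y , a≁y , c≁y) with adjacent⇒walk b~y
    ... | k , inj₁ b↝y , _ =
      inj₁ (a≁y , p + k , a↝b ++ʷ b↝y , nonNeighbour⇒∣ a≁y (a↝b ++ʷ b↝y))
    ... | k , inj₂ y↝b , _ =
      inj₂ (c≁y , k + q , y↝b ++ʷ b↝c , nonNeighbour⇒∣ (nonNeighbour-sym G c≁y) (y↝b ++ʷ b↝c))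

  between⇒noPrivateTriangle : ∀ {a b c} → Between Reach a b c → ¬ TriangleIn G (PrivateNeighbour G a b c)
  between⇒noPrivateTriangle (inj₁ (ab , bc)) = middle⇒noPrivateTriangle ab bc
  between⇒noPrivateTriangle (inj₂ (cb , ba)) =
    middle⇒noPrivateTriangle cb ba ∘ mapTriangle G λ (adj , a≁y , c≁y) → adj , c≁y , a≁y

  noTriangleOfPrivateTriangles : ¬ TriangleOfPrivateTriangles G
  noTriangleOfPrivateTriangles (privateTriangles a₁₂ a₁₃ a₂₃ t₁ t₂ t₃)
    with someBetween Reach (adjacent⇒reach a₁₂) (adjacent⇒reach a₁₃) (adjacent⇒reach a₂₃)
  ... | inj₁ middle₁        = between⇒noPrivateTriangle middle₁ t₁
  ... | inj₂ (inj₁ middle₂) = between⇒noPrivateTriangle middle₂ t₂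
  ... | inj₂ (inj₂ middle₃) = between⇒noPrivateTriangle middle₃ t₃

-- The argument works for every n.
willow⇒noTriangleOfPrivateTriangles : ∀ {N} {G : Graph N} → Willow G → ¬ TriangleOfPrivateTriangles G
willow⇒noTriangleOfPrivateTriangles (n , _ , T , f , willow) =
  WillowEmbedding.noTriangleOfPrivateTriangles n T f willow

proposition9p2 : (G : Graph 12) → IsTallStrider G → ¬ Willow G
proposition9p2 G strider willow =
  willow⇒noTriangleOfPrivateTriangles willow (tallStrider⇒triangleOfPrivateTriangles G strider)
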